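{- Let $k\geq 1$ and $n\geq 2$ be integers, and let ${\boldsymbol s}=(1,k+1,2k+1,\ldots,(n-1)k+1)$, i.e. $s_i=(i-1)k+1$ for $1\le i\le n$. Let \[ L_{k,n}=\left\{\lambda\in\mathbb{Z}^n : 0\leq \frac{\lambda_1}{s_1}\leq \frac{\lambda_2}{s_2}\leq\cdots\leq\frac{\lambda_n}{s_n}\right\}. \] Then the Hilbert basis $\mathcal{H}_{k,n}$ of $L_{k,n}$ (equivalently, of the cone $\mathcal{C}_{k,n}=\{\lambda\in\mathbb{R}^n: 0\le \lambda_1/s_1\le\cdots\le\lambda_n/s_n\}$) consists exactly of the following elements: \begin{itemize} \item for each subset $A=\{a_1<a_2<\cdots<a_m\}\subseteq[n-2]=\{1,\ldots,n-2\}$ (including $A=\emptyset$), the vector $v_A=(0,0,\ldots,0,a_1,a_2,\ldots,a_m,a_m+1)\in\mathbb{Z}^n$ (so $v_\emptyset=(0,\ldots,0,1)$); \item every $w\in L_{k,n}$ with $w_{n-1}=(n-2)k+1$ and $w_n=(n-1)k+1$. \end{itemize}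
   Context: For a pointed rational cone $C\subseteq\mathbb{R}^n$, the Hilbert basis of $C$ is the unique minimal (with respect to inclusion) subset of $C\cap\mathbb{Z}^n$ that generates the semigroup $C\cap\mathbb{Z}^n$ under addition with nonnegative integer coefficients. Note $L_{k,n}=\mathcal{C}_{k,n}\cap\mathbb{Z}^n$. -}

module Defs where

open import Data.Nat using (ℕ; zero; suc; _+_; _*_; _∸_; _≤_)
open import Data.Integer as ℤ using (ℤ; +_)
open import Data.Rational as ℚ using (ℚ; 0ℚ; _/_)
open import Data.Fin using (Fin; toℕ)
open import Data.Vec using (Vec; []; _∷_; lookup; tabulate; zipWith; replicate)
open import Data.List as List using ()
open import Data.Bool using (Bool; true; false)
open import Data.List using (List; []; _∷_; _++_; length; [_])
open import Data.List.Relation.Unary.All using (All)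
open import Data.Product using (Σ; ∃; _×_)
open import Data.Sum using (_⊎_)
open import Relation.Binary.PropositionalEquality using (_≡_)

-- integer vectors in ℤ^n (as length-indexed vectors, so that equality is
-- structural and no function extensionality is needed)
Vecℤ : ℕ → Set
Vecℤ n = Vec ℤ n

-- s_i = (i-1)k+1 for 1-indexed i; here i is 0-indexed: s i = i*k + 1
s : (k : ℕ) {n : ℕ} → Fin n → ℕ
s k i = suc (toℕ i * k)

ratio : (k : ℕ) {n : ℕ} → Vecℤ n → Fin n → ℚ
ratio k v i = lookup v i / s k i

L : (k n : ℕ) → Vecℤ n → Set
L k n v =
  (∀ (i : Fin n) → toℕ i ≡ 0 → 0ℚ ℚ.≤ ratio k v i) ×
  (∀ (i j : Fin n) → toℕ j ≡ suc (toℕ i) → ratio k v i ℚ.≤ ratio k v j)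

VSet : ℕ → Set₁
VSet n = Vecℤ n → Set

_⊆_ : ∀ {n} → VSet n → VSet n → Set
A ⊆ B = ∀ v → A v → B v

sumV : ∀ {n} → List (Vecℤ n) → Vecℤ n
sumV []       = replicate _ (+ 0)
sumV (u ∷ us) = zipWith ℤ._+_ u (sumV us)

-- v is a nonnegative integer combination of elements of H
-- (a finite sum of elements of H, with repetitions allowed)
InSemigroup : ∀ {n} → VSet n → Vecℤ n → Set
InSemigroup H v = Σ (List _) λ us → All H us × v ≡ sumV us

Generates : (k n : ℕ) → VSet n → Set
Generates k n H = H ⊆ L k n × (∀ v → L k n v → InSemigroup H v)

IsHilbertBasis : (k n : ℕ) → VSet n → Set₁
IsHilbertBasis k n H =
  Generates k n H × (∀ (H' : VSet n) → H' ⊆ H → Generates k n H' → H ⊆ H')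

elemsFrom : ∀ {m} → ℕ → Vec Bool m → List ℕ
elemsFrom j []          = []
elemsFrom j (true ∷ b)  = j ∷ elemsFrom (suc j) b
elemsFrom j (false ∷ b) = elemsFrom (suc j) b

lastOr0 : List ℕ → ℕ
lastOr0 []           = 0
lastOr0 (x ∷ [])     = x
lastOr0 (x ∷ y ∷ xs) = lastOr0 (y ∷ xs)

nth : List ℕ → ℕ → ℕ
nth []       _       = 0
nth (x ∷ xs) zero    = x
nth (x ∷ xs) (suc i) = nth xs i

-- for A = {a_1 < ... < a_m} ⊆ [n-2] (bit vector of length n-2, entry j ↔ j+1 ∈ A):
-- v_A = (0,...,0,a_1,...,a_m,a_m+1) ∈ ℤ^n, with a_0 = 0 so v_∅ = (0,...,0,1)
vAList : (n : ℕ) → Vec Bool (n ∸ 2) → List ℕ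
vAList n A = List.replicate (n ∸ suc (length as)) 0 ++ as ++ [ suc (lastOr0 as) ]
  where as = elemsFrom 1 A

vA : (n : ℕ) → Vec Bool (n ∸ 2) → Vecℤ n
vA n A = tabulate λ i → + nth (vAList n A) (toℕ i)

HB : (k n : ℕ) → VSet n
HB k n v =
  (Σ (Vec Bool (n ∸ 2)) λ A → v ≡ vA n A) ⊎
  (L k n v ×
   (∀ (i : Fin n) → toℕ i ≡ n ∸ 2 → lookup v i ≡ + ((n ∸ 2) * k + 1)) ×
   (∀ (i : Fin n) → toℕ i ≡ n ∸ 1 → lookup v i ≡ + ((n ∸ 1) * k + 1)))

module Submission where

-- Every element of L_{k,n} has nonnegative entries, so we work with sequences
-- g : ℕ → ℕ and the cross-multiplied form of the chain of inequalities,
-- g_i s_{i+1} ≤ g_{i+1} s_i ("g is ordered").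
--
-- An ordered g with last entry g_{P+1} > 0 splits as h + r with
-- h ∈ H_{k,n}, r ordered and r_{P+1} < g_{P+1}: if g_P ≥ s_P take h = min(s, g),
-- an element with top entries s_P, s_{P+1}; otherwise take h = v_A with entries
-- min(g_i, i) (i ≤ P) followed by min(g_P, P) + 1.  Induction on g_{P+1} gives
-- a decomposition into elements of H_{k,n}.
--
-- If u, w ∈ L_{k,n} are nonzero then u_P < u_{P+1} and
-- w_P < w_{P+1}, so u + w is no v_A (whose last step is +1); and u + w cannot
-- have top entries (s_P, s_{P+1}) since gcd(s_P, s_{P+1}) = 1 forces u_P, w_P ≥ s_P.
-- Hence every element of H_{k,n} lies in every generating set, which gives
-- both minimality and uniqueness of the Hilbert basis.

open import Defs
open import Data.Bool using (Bool; true; false)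
open import Data.Empty using (⊥; ⊥-elim)
open import Data.Fin using (Fin; toℕ; fromℕ<)
open import Data.Fin.Properties using (toℕ<n; toℕ-fromℕ<)
open import Data.Integer as ℤ using (ℤ; +_; ∣_∣)
import Data.Integer.Properties as ℤP
open import Data.List as List using (List; []; _∷_; _++_; length; [_]; applyUpTo)
open import Data.List.Properties using (++-assoc; length-++; length-replicate; length-applyUpTo)
open import Data.List.Relation.Unary.All as All using (All; []; _∷_)
open import Data.Nat as ℕ using (ℕ; zero; suc; _+_; _*_; _∸_; _≤_; _<_; z≤n; s≤s; _⊓_; NonZero)
open import Data.Nat.Properties
open import Data.Nat.Divisibility using (_∣_; divides; ∣m+n∣m⇒∣n; n∣m*n)
open import Data.Nat.Tactic.RingSolver using (solve-∀)
open import Data.Product using (Σ; _×_; _,_; proj₁; proj₂)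
open import Data.Rational as ℚ using (0ℚ; _/_)
import Data.Rational.Properties as ℚP
import Data.Rational.Unnormalised as ℚᵘ
import Data.Rational.Unnormalised.Properties as ℚᵘP
open import Data.Sum using (_⊎_; inj₁; inj₂)
open import Data.Unit using (⊤; tt)
open import Data.Vec as Vec using (Vec; []; _∷_; lookup; tabulate; zipWith; replicate)
open import Data.Vec.Properties
  using ( lookup∘tabulate; tabulate∘lookup; tabulate-cong; lookup-zipWith; lookup-replicate
        ; zipWith-identityˡ; zipWith-identityʳ)
open import Function.Bundles using (_⇔_; mk⇔)
open import Relation.Nullary using (yes; no; ¬_)
open import Relation.Binary.PropositionalEquality hiding ([_])

frac≤⇒cross : ∀ (i j : ℤ) (a b : ℕ) →
  (i / suc a) ℚ.≤ (j / suc b) → i ℤ.* + suc b ℤ.≤ j ℤ.* + suc a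
frac≤⇒cross i j a b h =
  ℚᵘP.drop-*≤* (ℚᵘP.≤-respˡ-≃ (ℚP.toℚᵘ-fromℚᵘ (ℚᵘ.mkℚᵘ i a))
    (ℚᵘP.≤-respʳ-≃ (ℚP.toℚᵘ-fromℚᵘ (ℚᵘ.mkℚᵘ j b)) (ℚP.toℚᵘ-mono-≤ h)))

cross⇒frac≤ : ∀ (i j : ℤ) (a b : ℕ) →
  i ℤ.* + suc b ℤ.≤ j ℤ.* + suc a → (i / suc a) ℚ.≤ (j / suc b)
cross⇒frac≤ i j a b h =
  ℚP.toℚᵘ-cancel-≤ (ℚᵘP.≤-respˡ-≃ (ℚᵘP.≃-sym (ℚP.toℚᵘ-fromℚᵘ (ℚᵘ.mkℚᵘ i a)))
    (ℚᵘP.≤-respʳ-≃ (ℚᵘP.≃-sym (ℚP.toℚᵘ-fromℚᵘ (ℚᵘ.mkℚᵘ j b))) (ℚᵘ.*≤* h)))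

ℕfrac≤⇒cross : ∀ (a b c d : ℕ) → ((+ a) / suc c) ℚ.≤ ((+ b) / suc d) → a * suc d ≤ b * suc c
ℕfrac≤⇒cross a b c d h with frac≤⇒cross (+ a) (+ b) c d h
... | r rewrite sym (ℤP.pos-* a (suc d)) | sym (ℤP.pos-* b (suc c)) = ℤP.drop‿+≤+ r

cross⇒ℕfrac≤ : ∀ (a b c d : ℕ) → a * suc d ≤ b * suc c → ((+ a) / suc c) ℚ.≤ ((+ b) / suc d)
cross⇒ℕfrac≤ a b c d h =
  cross⇒frac≤ (+ a) (+ b) c d (subst₂ ℤ._≤_ (ℤP.pos-* a (suc d)) (ℤP.pos-* b (suc c)) (ℤ.+≤+ h))

0≤frac⇒0≤num : ∀ (z : ℤ) (c : ℕ) → 0ℚ ℚ.≤ (z / suc c) → ℤ.0ℤ ℤ.≤ z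
0≤frac⇒0≤num z c h = subst (ℤ._≤_ ℤ.0ℤ) (ℤP.*-identityʳ z) (frac≤⇒cross (+ 0) z 0 c h)

0≤ℕfrac : ∀ (a c : ℕ) → 0ℚ ℚ.≤ ((+ a) / suc c)
0≤ℕfrac a c = cross⇒frac≤ (+ 0) (+ a) 0 c (subst (ℤ._≤_ ℤ.0ℤ) (sym (ℤP.*-identityʳ (+ a))) (ℤ.+≤+ z≤n))

-- s_i = ik + 1, the denominator of the i-th coordinate, counting coordinates from 0
-- (the paper's s_{i+1}); all indices in this file start at 0.
den : ℕ → ℕ → ℕ
den k i = suc (i * k)

Ordered : ℕ → ℕ → (ℕ → ℕ) → Set
Ordered k n g = ∀ i → suc i < n → g i * den k (suc i) ≤ g (suc i) * den k i

toVec : (n : ℕ) → (ℕ → ℕ) → Vec ℤ n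
toVec n g = tabulate (λ i → + g (toℕ i))

lookup-toVec : ∀ {n} g (i : Fin n) → lookup (toVec n g) i ≡ + g (toℕ i)
lookup-toVec g i = lookup∘tabulate (λ i → + g (toℕ i)) i

vec-ext : ∀ {n} (u v : Vec ℤ n) → (∀ i → lookup u i ≡ lookup v i) → u ≡ v
vec-ext u v h = trans (sym (tabulate∘lookup u)) (trans (tabulate-cong h) (tabulate∘lookup v))

toVec-cong : ∀ n g g' → (∀ i → i < n → g i ≡ g' i) → toVec n g ≡ toVec n g'
toVec-cong n g g' h = tabulate-cong (λ i → cong +_ (h (toℕ i) (toℕ<n i)))

toVec-+ : ∀ n g g' → zipWith ℤ._+_ (toVec n g) (toVec n g') ≡ toVec n (λ i → g i + g' i)
toVec-+ n g g' = vec-ext _ _ λ i → begin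
  lookup (zipWith ℤ._+_ (toVec n g) (toVec n g')) i ≡⟨ lookup-zipWith ℤ._+_ i (toVec n g) (toVec n g') ⟩
  lookup (toVec n g) i ℤ.+ lookup (toVec n g') i    ≡⟨ cong₂ ℤ._+_ (lookup-toVec g i) (lookup-toVec g' i) ⟩
  + g (toℕ i) ℤ.+ + g' (toℕ i)                      ≡⟨ sym (ℤP.pos-+ (g (toℕ i)) (g' (toℕ i))) ⟩
  + (g (toℕ i) + g' (toℕ i))                        ≡⟨ sym (lookup-toVec (λ j → g j + g' j) i) ⟩
  lookup (toVec n (λ j → g j + g' j)) i             ∎
  where open ≡-Reasoning

toVec-0 : ∀ n → replicate n (+ 0) ≡ toVec n (λ _ → 0)
toVec-0 n = vec-ext _ _ λ i → trans (lookup-replicate i (+ 0)) (sym (lookup-toVec _ i))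

ordered⇒L : ∀ k n g → Ordered k n g → L k n (toVec n g)
ordered⇒L k n g o = nonneg , chain
  where
  nonneg : ∀ (i : Fin n) → toℕ i ≡ 0 → 0ℚ ℚ.≤ ratio k (toVec n g) i
  nonneg i _ rewrite lookup-toVec g i = 0≤ℕfrac (g (toℕ i)) (toℕ i * k)
  chain : ∀ (i j : Fin n) → toℕ j ≡ suc (toℕ i) → ratio k (toVec n g) i ℚ.≤ ratio k (toVec n g) j
  chain i j e rewrite lookup-toVec g i | lookup-toVec g j | e =
    cross⇒ℕfrac≤ (g (toℕ i)) (g (suc (toℕ i))) (toℕ i * k) (suc (toℕ i) * k)
      (o (toℕ i) (subst (_< n) e (toℕ<n j)))

L⇒ordered-toVec : ∀ k n g → L k n (toVec n g) → Ordered k n g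
L⇒ordered-toVec k n g (_ , chain) i si<n =
  ℕfrac≤⇒cross (g i) (g (suc i)) (i * k) (suc i * k)
    (subst₂ ℚ._≤_ (ratio-at i i<n) (ratio-at (suc i) si<n)
      (chain (fromℕ< i<n) (fromℕ< si<n) (trans (toℕ-fromℕ< si<n) (cong suc (sym (toℕ-fromℕ< i<n))))))
  where
  i<n : i < n
  i<n = <-trans (n<1+n i) si<n
  ratio-at : ∀ m (m<n : m < n) → ratio k (toVec n g) (fromℕ< m<n) ≡ (+ g m) / suc (m * k)
  ratio-at m m<n rewrite lookup-toVec g (fromℕ< m<n) | toℕ-fromℕ< m<n = refl

entry : ∀ {n} → Vec ℤ n → ℕ → ℤ
entry []       _       = + 0
entry (x ∷ xs) zero    = x
entry (x ∷ xs) (suc i) = entry xs i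

lookup-entry : ∀ {n} (v : Vec ℤ n) (i : Fin n) → lookup v i ≡ entry v (toℕ i)
lookup-entry (x ∷ v) Fin.zero    = refl
lookup-entry (x ∷ v) (Fin.suc i) = lookup-entry v i

coords : ∀ {n} → Vec ℤ n → ℕ → ℕ
coords v i = ∣ entry v i ∣

L⇒0≤ratio : ∀ k n v → L k n v → ∀ m (i : Fin n) → toℕ i ≡ m → 0ℚ ℚ.≤ ratio k v i
L⇒0≤ratio k n v (nonneg , chain) zero    i e = nonneg i e
L⇒0≤ratio k n v (nonneg , chain) (suc m) i e =
  ℚP.≤-trans (L⇒0≤ratio k n v (nonneg , chain) m j (toℕ-fromℕ< m<n))
             (chain j i (trans e (cong suc (sym (toℕ-fromℕ< m<n)))))
  where
  m<n : m < n
  m<n = <-trans (n<1+n m) (subst (_< n) e (toℕ<n i))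
  j : Fin n
  j = fromℕ< m<n

L⇒toVec : ∀ k n v → L k n v → v ≡ toVec n (coords v)
L⇒toVec k n v Lv = vec-ext _ _ λ i → begin
  lookup v i                ≡⟨ sym (ℤP.0≤i⇒+∣i∣≡i (nonneg i)) ⟩
  + ∣ lookup v i ∣          ≡⟨ cong (λ z → + ∣ z ∣) (lookup-entry v i) ⟩
  + coords v (toℕ i)        ≡⟨ sym (lookup-toVec (coords v) i) ⟩
  lookup (toVec n (coords v)) i ∎
  where
  open ≡-Reasoning
  nonneg : ∀ i → ℤ.0ℤ ℤ.≤ lookup v i
  nonneg i = 0≤frac⇒0≤num (lookup v i) (toℕ i * k) (L⇒0≤ratio k n v Lv (toℕ i) i refl)

L⇒ordered : ∀ k n v → L k n v → Ordered k n (coords v)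
L⇒ordered k n v Lv = L⇒ordered-toVec k n (coords v) (subst (L k n) (L⇒toVec k n v Lv) Lv)

coords-toVec : ∀ n c i → i < n → coords (toVec n c) i ≡ c i
coords-toVec n c i i<n = cong ∣_∣ (begin
  entry (toVec n c) i                    ≡⟨ cong (entry (toVec n c)) (sym (toℕ-fromℕ< i<n)) ⟩
  entry (toVec n c) (toℕ (fromℕ< i<n))   ≡⟨ sym (lookup-entry (toVec n c) (fromℕ< i<n)) ⟩
  lookup (toVec n c) (fromℕ< i<n)        ≡⟨ lookup-toVec c (fromℕ< i<n) ⟩
  + c (toℕ (fromℕ< i<n))                 ≡⟨ cong (λ j → + c j) (toℕ-fromℕ< i<n) ⟩
  + c i                                  ∎)
  where open ≡-Reasoning

coords-at : ∀ {n} (v : Vec ℤ n) m x → m < n →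
  (∀ (i : Fin n) → toℕ i ≡ m → lookup v i ≡ + x) → coords v m ≡ x
coords-at v m x m<n at = cong ∣_∣ (trans (cong (entry v) (sym (toℕ-fromℕ< m<n)))
  (trans (sym (lookup-entry v (fromℕ< m<n))) (at (fromℕ< m<n) (toℕ-fromℕ< m<n))))

den-suc : ∀ k i → den k (suc i) ≡ den k i + k
den-suc k i = cong suc (+-comm k (i * k))

propagate : ∀ n (Q : ℕ → Set) → (∀ i → suc i < n → Q i → Q (suc i)) →
  ∀ {i j} → i ≤ j → j < n → Q i → Q j
propagate n Q step {i} {zero}  z≤n  _    q = q
propagate n Q step {i} {suc j} i≤sj sj<n q with m≤n⇒m<n∨m≡n i≤sj
... | inj₂ refl = q
... | inj₁ i<sj = step j sj<n (propagate n Q step (≤-pred i<sj) (<-trans (n<1+n j) sj<n) q)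

-- Ordered sequences are nondecreasing (since s is).
ordered-step : ∀ k n g → Ordered k n g → ∀ i → suc i < n → g i ≤ g (suc i)
ordered-step k n g o i si<n = *-cancelʳ-≤ (g i) (g (suc i)) (den k i)
  (≤-trans (*-monoʳ-≤ (g i) (subst (den k i ≤_) (sym (den-suc k i)) (m≤m+n (den k i) k))) (o i si<n))

ordered-mono : ∀ k n g → Ordered k n g → ∀ {i j} → i ≤ j → j < n → g i ≤ g j
ordered-mono k n g o {i} i≤j j<n =
  propagate n (λ j → g i ≤ g j) (λ j lt le → ≤-trans le (ordered-step k n g o j lt)) i≤j j<n ≤-refl

ordered-zero : ∀ k N g → Ordered k (suc N) g → g N ≡ 0 → ∀ i → i < suc N → g i ≡ 0
ordered-zero k N g o gN≡0 i (s≤s i≤N) = n≤0⇒n≡0 (subst (g i ≤_) gN≡0 (ordered-mono k (suc N) g o i≤N ≤-refl))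

ordered-strict : ∀ k n g → 1 ≤ k → Ordered k n g → ∀ i → suc i < n → 0 < g (suc i) → g i < g (suc i)
ordered-strict k n g k≥1 o i si<n pos with g i <? g (suc i)
... | yes lt = lt
... | no ¬lt = ⊥-elim (<-irrefl refl (<-≤-trans pos (≤-trans ge (≤-reflexive gi≡0))))
  where
  ge : g (suc i) ≤ g i
  ge = ≮⇒≥ ¬lt
  S : ℕ
  S = den k i
  gik≤0 : g i * S + g i * k ≤ g i * S + 0
  gik≤0 = begin
    g i * S + g i * k    ≡⟨ sym (*-distribˡ-+ (g i) S k) ⟩
    g i * (S + k)        ≡⟨ cong (g i *_) (sym (den-suc k i)) ⟩
    g i * den k (suc i)  ≤⟨ o i si<n ⟩
    g (suc i) * S        ≤⟨ *-monoˡ-≤ S ge ⟩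
    g i * S              ≡⟨ sym (+-identityʳ (g i * S)) ⟩
    g i * S + 0          ∎
    where open ≤-Reasoning
  gi≡0 : g i ≡ 0
  gi≡0 with m*n≡0⇒m≡0∨n≡0 (g i) (n≤0⇒n≡0 (+-cancelˡ-≤ (g i * S) _ _ gik≤0))
  ... | inj₁ e = e
  ... | inj₂ e = ⊥-elim (<-irrefl (sym e) k≥1)

ordered-+ : ∀ k n g g' → Ordered k n g → Ordered k n g' → Ordered k n (λ i → g i + g' i)
ordered-+ k n g g' o o' i lt = begin
  (g i + g' i) * den k (suc i)                    ≡⟨ *-distribʳ-+ (den k (suc i)) (g i) (g' i) ⟩
  g i * den k (suc i) + g' i * den k (suc i)      ≤⟨ +-mono-≤ (o i lt) (o' i lt) ⟩
  g (suc i) * den k i + g' (suc i) * den k i      ≡⟨ sym (*-distribʳ-+ (den k i) (g (suc i)) (g' (suc i))) ⟩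
  (g (suc i) + g' (suc i)) * den k i              ∎
  where open ≤-Reasoning

-- ... and, since s itself is ordered (with equality), under min(s, -) and (- ∸ s).
ordered-den⊓ : ∀ k n g → Ordered k n g → Ordered k n (λ i → den k i ⊓ g i)
ordered-den⊓ k n g o i lt = begin
  (S ⊓ g i) * S'             ≡⟨ *-distribʳ-⊓ S' S (g i) ⟩
  (S * S') ⊓ (g i * S')      ≤⟨ ⊓-mono-≤ (≤-reflexive (*-comm S S')) (o i lt) ⟩
  (S' * S) ⊓ (g (suc i) * S) ≡⟨ sym (*-distribʳ-⊓ S S' (g (suc i))) ⟩
  (S' ⊓ g (suc i)) * S       ∎
  where
  open ≤-Reasoning
  S S' : ℕ
  S = den k i
  S' = den k (suc i)

ordered-∸den : ∀ k n g → Ordered k n g → Ordered k n (λ i → g i ∸ den k i)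
ordered-∸den k n g o i lt = begin
  (g i ∸ S) * S'             ≡⟨ *-distribʳ-∸ S' (g i) S ⟩
  g i * S' ∸ S * S'          ≤⟨ ∸-mono (o i lt) (≤-reflexive (*-comm S' S)) ⟩
  g (suc i) * S ∸ S' * S     ≡⟨ sym (*-distribʳ-∸ S (g (suc i)) S') ⟩
  (g (suc i) ∸ S') * S       ∎
  where
  open ≤-Reasoning
  S S' : ℕ
  S = den k i
  S' = den k (suc i)

den≤-step : ∀ k n g → Ordered k n g → ∀ i → suc i < n → den k i ≤ g i → den k (suc i) ≤ g (suc i)
den≤-step k n g o i lt le = *-cancelʳ-≤ (den k (suc i)) (g (suc i)) (den k i)
  (≤-trans (≤-reflexive (*-comm (den k (suc i)) (den k i))) (≤-trans (*-monoˡ-≤ (den k (suc i)) le) (o i lt)))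

-- Staircase step: if x ≤ p and x < y then x s_{p+1} ≤ y s_p (entries x, y at
-- positions p, p+1); this is why each v_A lies in L_{k,n}.
staircase-step : ∀ k x p y → x ≤ p → suc x ≤ y → x * den k (suc p) ≤ y * den k p
staircase-step k x p y x≤p sx≤y = begin
  x * den k (suc p)        ≡⟨ cong (x *_) (den-suc k p) ⟩
  x * (den k p + k)        ≡⟨ *-distribˡ-+ x (den k p) k ⟩
  x * den k p + x * k      ≤⟨ +-monoʳ-≤ (x * den k p) (≤-trans (*-monoˡ-≤ k x≤p) (n≤1+n (p * k))) ⟩
  x * den k p + den k p    ≡⟨ +-comm (x * den k p) (den k p) ⟩
  suc x * den k p          ≤⟨ *-monoˡ-≤ (den k p) sx≤y ⟩
  y * den k p              ∎
  where open ≤-Reasoning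

-- s_j = jk + 1 and s_{j+1} = s_j + k are coprime, so x s_{j+1} = y s_j with x > 0
-- forces s_j ∣ x, in particular s_j ≤ x.
den-coprime : ∀ k j x y → 1 ≤ k → x * den k (suc j) ≡ y * den k j → 0 < x → den k j ≤ x
den-coprime k j x y k≥1 eq x>0 = fromQuotient k∣d
  where
  instance
    k≢0 : NonZero k
    k≢0 = ℕ.>-nonZero k≥1
  S : ℕ
  S = den k j
  x*S+x*k≡y*S : x * S + x * k ≡ y * S
  x*S+x*k≡y*S = trans (sym (*-distribˡ-+ x S k)) (trans (cong (x *_) (sym (den-suc k j))) eq)
  x≤y : x ≤ y
  x≤y = *-cancelʳ-≤ x y S (subst (x * S ≤_) x*S+x*k≡y*S (m≤m+n (x * S) (x * k)))
  d : ℕ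
  d = y ∸ x
  -- x k = d s_j = d (jk + 1), so k ∣ d.
  xk≡dS : x * k ≡ d * S
  xk≡dS = +-cancelˡ-≡ (x * S) _ _
    (trans x*S+x*k≡y*S (trans (cong (_* S) (sym (m+[n∸m]≡n x≤y))) (*-distribʳ-+ S x d)))
  k∣d : k ∣ d
  k∣d = ∣m+n∣m⇒∣n (subst (k ∣_) (trans xk≡dS (trans (*-suc d (j * k)) (+-comm d (d * (j * k))))) (n∣m*n x))
                  (divides (d * j) (sym (*-assoc d j k)))
  -- Writing d = q k gives x = q S, and q ≠ 0 because x > 0.
  fromQuotient : k ∣ d → S ≤ x
  fromQuotient (divides q d≡qk) with q
  ... | zero  = ⊥-elim (<-irrefl refl (<-≤-trans x>0 (≤-reflexive x≡0)))
    where
    x≡0 : x ≡ 0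
    x≡0 = *-cancelʳ-≡ x 0 k (trans xk≡dS (cong (_* S) d≡qk))
  ... | suc e = subst (S ≤_) (sym x≡) (m≤m+n S (e * S))
    where
    x≡ : x ≡ suc e * S
    x≡ = *-cancelʳ-≡ x (suc e * S) k (begin
      x * k              ≡⟨ xk≡dS ⟩
      d * S              ≡⟨ cong (_* S) d≡qk ⟩
      suc e * k * S      ≡⟨ *-assoc (suc e) k S ⟩
      suc e * (k * S)    ≡⟨ cong (suc e *_) (*-comm k S) ⟩
      suc e * (S * k)    ≡⟨ sym (*-assoc (suc e) S k) ⟩
      suc e * S * k      ∎)
      where open ≡-Reasoning

shift-step : ∀ k i x y → suc (x * den k (suc i)) ≤ y * den k i →
  (x ∸ i) * den k (suc i) ≤ (y ∸ suc i) * den k i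
shift-step k i x y lt = begin
  (x ∸ i) * S'                ≡⟨ *-distribʳ-∸ S' x i ⟩
  x * S' ∸ i * S'             ≤⟨ ∸-monoˡ-≤ (i * S') (∸-monoˡ-≤ 1 lt) ⟩
  (y * S ∸ 1) ∸ i * S'        ≡⟨ ∸-+-assoc (y * S) 1 (i * S') ⟩
  y * S ∸ suc (i * S')        ≡⟨ cong (y * S ∸_) (sym (i+1·s≡1+i·s' i k)) ⟩
  y * S ∸ suc i * S           ≡⟨ sym (*-distribʳ-∸ S y (suc i)) ⟩
  (y ∸ suc i) * S             ∎
  where
  open ≤-Reasoning
  S S' : ℕ
  S = den k i
  S' = den k (suc i)
  i+1·s≡1+i·s' : ∀ i k → suc i * suc (i * k) ≡ suc (i * suc (k + i * k))
  i+1·s≡1+i·s' = solve-∀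

nth-++ˡ : ∀ xs ys i → i < length xs → nth (xs ++ ys) i ≡ nth xs i
nth-++ˡ (x ∷ xs) ys zero    lt       = refl
nth-++ˡ (x ∷ xs) ys (suc i) (s≤s lt) = nth-++ˡ xs ys i lt

nth-++ʳ : ∀ xs ys j → nth (xs ++ ys) (length xs + j) ≡ nth ys j
nth-++ʳ []       ys j = refl
nth-++ʳ (x ∷ xs) ys j = nth-++ʳ xs ys j

nth-last : ∀ xs → nth xs (length xs ∸ 1) ≡ lastOr0 xs
nth-last []          = refl
nth-last (x ∷ [])    = refl
nth-last (x ∷ y ∷ r) = nth-last (y ∷ r)

lastOr0-0∷ : ∀ ys → lastOr0 (0 ∷ ys) ≡ lastOr0 ys
lastOr0-0∷ []       = refl
lastOr0-0∷ (y ∷ ys) = refl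

lastOr0-zeros++ : ∀ z xs → lastOr0 (List.replicate z 0 ++ xs) ≡ lastOr0 xs
lastOr0-zeros++ zero    xs = refl
lastOr0-zeros++ (suc z) xs = trans (lastOr0-0∷ (List.replicate z 0 ++ xs)) (lastOr0-zeros++ z xs)

IncreasingFrom : ℕ → List ℕ → Set
IncreasingFrom j []       = ⊤
IncreasingFrom j (x ∷ xs) = j ≤ x × IncreasingFrom (suc x) xs

increasing-weaken : ∀ i j xs → i ≤ j → IncreasingFrom j xs → IncreasingFrom i xs
increasing-weaken i j []       le inc       = tt
increasing-weaken i j (x ∷ xs) le (j≤x , inc) = ≤-trans le j≤x , inc

bound-shift : ∀ {j L xs} → All (_< j + suc L) xs → All (_< suc j + L) xs
bound-shift {j} {L} = All.map (λ {y} lt → subst (y <_) (+-suc j L) lt)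

bound-unshift : ∀ {j L xs} → All (_< suc j + L) xs → All (_< j + suc L) xs
bound-unshift {j} {L} = All.map (λ {y} lt → subst (y <_) (sym (+-suc j L)) lt)

elemsFrom-increasing : ∀ {L} j (B : Vec Bool L) → IncreasingFrom j (elemsFrom j B)
elemsFrom-increasing j []          = tt
elemsFrom-increasing j (true ∷ B)  = ≤-refl , elemsFrom-increasing (suc j) B
elemsFrom-increasing j (false ∷ B) = increasing-weaken j (suc j) _ (n≤1+n j) (elemsFrom-increasing (suc j) B)

elemsFrom-bounded : ∀ {L} j (B : Vec Bool L) → All (_< j + L) (elemsFrom j B)
elemsFrom-bounded j [] = []
elemsFrom-bounded {suc L} j (true ∷ B)  =
  subst (j <_) (sym (+-suc j L)) (s≤s (m≤m+n j L)) ∷ bound-unshift (elemsFrom-bounded (suc j) B)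
elemsFrom-bounded {suc L} j (false ∷ B) = bound-unshift (elemsFrom-bounded (suc j) B)

elemsFrom-length : ∀ {L} j (B : Vec Bool L) → length (elemsFrom j B) ≤ L
elemsFrom-length j []          = z≤n
elemsFrom-length j (true ∷ B)  = s≤s (elemsFrom-length (suc j) B)
elemsFrom-length j (false ∷ B) = m≤n⇒m≤1+n (elemsFrom-length (suc j) B)

elemsFrom-onto : ∀ L j xs → IncreasingFrom j xs → All (_< j + L) xs → Σ (Vec Bool L) λ B → elemsFrom j B ≡ xs
elemsFrom-onto zero j [] inc bd = [] , refl
elemsFrom-onto zero j (x ∷ xs) (j≤x , _) (x<j+0 ∷ _) =
  ⊥-elim (<-irrefl refl (≤-<-trans j≤x (subst (x <_) (+-identityʳ j) x<j+0)))
elemsFrom-onto (suc L) j [] inc bd = Vec.replicate (suc L) false , noneFrom j (suc L)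
  where
  noneFrom : ∀ j L → elemsFrom j (Vec.replicate L false) ≡ []
  noneFrom j zero    = refl
  noneFrom j (suc L) = noneFrom (suc j) L
elemsFrom-onto (suc L) j (x ∷ xs) (j≤x , inc) bd with j ≟ x
... | yes refl with elemsFrom-onto L (suc j) xs inc (bound-shift (All.tail bd))
...   | B , eq = (true ∷ B) , cong (x ∷_) eq
elemsFrom-onto (suc L) j (x ∷ xs) (j≤x , inc) bd | no j≢x
  with elemsFrom-onto L (suc j) (x ∷ xs) (≤∧≢⇒< j≤x j≢x , inc) (bound-shift bd)
... | B , eq = (false ∷ B) , eq

BoundedFrom : ℕ → List ℕ → Set
BoundedFrom q []       = ⊤
BoundedFrom q (x ∷ xs) = x ≤ q × BoundedFrom (suc q) xs

increasing-room : ∀ a x xs U → IncreasingFrom a (x ∷ xs) → All (_< U) (x ∷ xs) → suc x + length xs ≤ U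
increasing-room a x []      U inc (x<U ∷ []) = subst (_≤ U) (sym (+-identityʳ (suc x))) x<U
increasing-room a x (y ∷ r) U (_ , (sx≤y , inc)) (_ ∷ bd) = begin
  suc x + suc (length r)   ≡⟨ +-suc (suc x) (length r) ⟩
  suc (suc x + length r)   ≤⟨ s≤s (+-monoˡ-≤ (length r) sx≤y) ⟩
  suc y + length r         ≤⟨ increasing-room (suc x) y r U (sx≤y , inc) bd ⟩
  U                        ∎
  where open ≤-Reasoning

increasing-bounded : ∀ a xs U q → IncreasingFrom a xs → All (_< U) xs → q + length xs ≡ U → BoundedFrom q xs
increasing-bounded a []       U q inc bd e = tt
increasing-bounded a (x ∷ xs) U q inc bd e =
  x≤q , increasing-bounded (suc x) xs U (suc q) (proj₂ inc) (All.tail bd) (trans (sym (+-suc q (length xs))) e)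
  where
  x≤q : x ≤ q
  x≤q = ≤-pred (+-cancelʳ-≤ (length xs) (suc x) (suc q)
          (≤-trans (increasing-room a x xs U inc bd) (≤-reflexive (trans (sym e) (+-suc q (length xs))))))

Staircase : ℕ → List ℕ → Set
Staircase p []          = ⊤
Staircase p (x ∷ [])    = ⊤
Staircase p (x ∷ y ∷ r) = (x ≡ 0 ⊎ (x ≤ p × x < y)) × Staircase (suc p) (y ∷ r)

staircase-zeros++ : ∀ z p ys → Staircase (p + z) ys → Staircase p (List.replicate z 0 ++ ys)
staircase-zeros++ zero    p ys st = subst (λ q → Staircase q ys) (+-identityʳ p) st
staircase-zeros++ (suc z) p ys st = cons0 (List.replicate z 0 ++ ys)
    (staircase-zeros++ z (suc p) ys (subst (λ q → Staircase q ys) (+-suc p z) st))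
  where
  cons0 : ∀ ys → Staircase (suc p) ys → Staircase p (0 ∷ ys)
  cons0 []       st = tt
  cons0 (y ∷ ys) st = inj₁ refl , st

staircase-increasing : ∀ q as a → IncreasingFrom a as → BoundedFrom q as → Staircase q (as ++ [ suc (lastOr0 as) ])
staircase-increasing q []          a _         _           = tt
staircase-increasing q (x ∷ [])    a _         (x≤q , _)   = inj₂ (x≤q , ≤-refl) , tt
staircase-increasing q (x ∷ y ∷ r) a (_ , inc) (x≤q , bnd) =
  inj₂ (x≤q , proj₁ inc) , staircase-increasing (suc q) (y ∷ r) (suc x) inc bnd

staircase-nth : ∀ p ℓ → Staircase p ℓ → ∀ i → suc i < length ℓ →
  nth ℓ i ≡ 0 ⊎ (nth ℓ i ≤ p + i × nth ℓ i < nth ℓ (suc i))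
staircase-nth p (x ∷ [])    _                  i       (s≤s ())
staircase-nth p (x ∷ y ∷ r) (inj₁ e , _)       zero    lt = inj₁ e
staircase-nth p (x ∷ y ∷ r) (inj₂ (a , b) , _) zero    lt = inj₂ (subst (x ≤_) (sym (+-identityʳ p)) a , b)
staircase-nth p (x ∷ y ∷ r) (_ , st)           (suc i) (s≤s lt) with staircase-nth (suc p) (y ∷ r) st i lt
... | inj₁ e       = inj₁ e
... | inj₂ (a , b) = inj₂ (subst (nth (y ∷ r) i ≤_) (sym (+-suc p i)) a , b)

staircase⇒ordered : ∀ k ℓ → Staircase 0 ℓ → Ordered k (length ℓ) (nth ℓ)
staircase⇒ordered k ℓ st i lt with staircase-nth 0 ℓ st i lt
... | inj₁ e       rewrite e = z≤n
... | inj₂ (a , b) = staircase-step k _ i _ a b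

module _ (P : ℕ) (A : Vec Bool P) where
  private
    as : List ℕ
    as = elemsFrom 1 A
    z t : ℕ
    z = suc P ∸ length as
    t = suc (lastOr0 as)
    Y : List ℕ
    Y = List.replicate z 0 ++ as

    z+m≡1+P : z + length as ≡ suc P
    z+m≡1+P = m∸n+n≡m (m≤n⇒m≤1+n (elemsFrom-length 1 A))

    length-Y : length Y ≡ suc P
    length-Y = trans (length-++ (List.replicate z 0)) (trans (cong (_+ length as) (length-replicate z)) z+m≡1+P)

    vAList≡Y++t : vAList (suc (suc P)) A ≡ Y ++ [ t ]
    vAList≡Y++t = sym (++-assoc (List.replicate z 0) as [ t ])

    length-vAList : length (vAList (suc (suc P)) A) ≡ suc (suc P)
    length-vAList = trans (cong length vAList≡Y++t)
      (trans (length-++ Y) (trans (cong (_+ 1) length-Y) (+-comm (suc P) 1)))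

    staircase-vA : Staircase 0 (vAList (suc (suc P)) A)
    staircase-vA = staircase-zeros++ z 0 (as ++ [ t ])
      (staircase-increasing z as 1 inc (increasing-bounded 1 as (suc P) z inc (elemsFrom-bounded 1 A) z+m≡1+P))
      where
      inc : IncreasingFrom 1 as
      inc = elemsFrom-increasing 1 A

  vA-ordered : ∀ k → Ordered k (suc (suc P)) (nth (vAList (suc (suc P)) A))
  vA-ordered k i lt =
    staircase⇒ordered k (vAList (suc (suc P)) A) staircase-vA i (subst (suc i <_) (sym length-vAList) lt)

  vA-last-step : nth (vAList (suc (suc P)) A) (suc P) ≡ suc (nth (vAList (suc (suc P)) A) P)
  vA-last-step rewrite vAList≡Y++t = begin
    nth (Y ++ [ t ]) (suc P)             ≡⟨ cong (nth (Y ++ [ t ])) (sym (trans (+-identityʳ (length Y)) length-Y)) ⟩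
    nth (Y ++ [ t ]) (length Y + 0)      ≡⟨ nth-++ʳ Y [ t ] 0 ⟩
    t                                    ≡⟨ cong suc (sym (lastOr0-zeros++ z as)) ⟩
    suc (lastOr0 Y)                      ≡⟨ cong suc (sym (nth-last Y)) ⟩
    suc (nth Y (length Y ∸ 1))           ≡⟨ cong (λ q → suc (nth Y (q ∸ 1))) length-Y ⟩
    suc (nth Y P)                        ≡⟨ cong suc (sym (nth-++ˡ Y [ t ] P (subst (P <_) (sym length-Y) ≤-refl))) ⟩
    suc (nth (Y ++ [ t ]) P)             ∎
    where open ≡-Reasoning

leadingZeros : List ℕ → ℕ
leadingZeros []           = 0
leadingZeros (zero ∷ xs)  = suc (leadingZeros xs)
leadingZeros (suc x ∷ xs) = 0

dropZeros : List ℕ → List ℕ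
dropZeros []           = []
dropZeros (zero ∷ xs)  = dropZeros xs
dropZeros (suc x ∷ xs) = suc x ∷ xs

zeros++dropZeros : ∀ xs → List.replicate (leadingZeros xs) 0 ++ dropZeros xs ≡ xs
zeros++dropZeros []           = refl
zeros++dropZeros (zero ∷ xs)  = cong (0 ∷_) (zeros++dropZeros xs)
zeros++dropZeros (suc x ∷ xs) = refl

length-dropZeros : ∀ xs → length xs ≡ leadingZeros xs + length (dropZeros xs)
length-dropZeros xs = trans (cong length (sym (zeros++dropZeros xs)))
  (trans (length-++ (List.replicate (leadingZeros xs) 0)) (cong (_+ length (dropZeros xs)) (length-replicate (leadingZeros xs))))

lastOr0-dropZeros : ∀ xs → lastOr0 (dropZeros xs) ≡ lastOr0 xs
lastOr0-dropZeros xs = trans (sym (lastOr0-zeros++ (leadingZeros xs) (dropZeros xs))) (cong lastOr0 (zeros++dropZeros xs))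

All-dropZeros : ∀ (Q : ℕ → Set) xs → All Q xs → All Q (dropZeros xs)
All-dropZeros Q []           a       = a
All-dropZeros Q (zero ∷ xs)  (_ ∷ a) = All-dropZeros Q xs a
All-dropZeros Q (suc x ∷ xs) a       = a

ZeroThenIncreasing : List ℕ → Set
ZeroThenIncreasing []          = ⊤
ZeroThenIncreasing (x ∷ [])    = ⊤
ZeroThenIncreasing (x ∷ y ∷ r) = (x ≡ 0 ⊎ x < y) × ZeroThenIncreasing (y ∷ r)

dropZeros-increasing : ∀ xs → ZeroThenIncreasing xs → IncreasingFrom 1 (dropZeros xs)
dropZeros-increasing []           zti = tt
dropZeros-increasing (zero ∷ [])  zti = tt
dropZeros-increasing (zero ∷ y ∷ r) (_ , zti) = dropZeros-increasing (y ∷ r) zti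
dropZeros-increasing (suc x ∷ xs) zti = s≤s z≤n , afterPositive x xs zti
  where
  afterPositive : ∀ x xs → ZeroThenIncreasing (suc x ∷ xs) → IncreasingFrom (suc (suc x)) xs
  afterPositive x []          zti                = tt
  afterPositive x (zero ∷ r)  (inj₁ () , _)
  afterPositive x (zero ∷ r)  (inj₂ () , _)
  afterPositive x (suc y ∷ r) (inj₁ () , _)
  afterPositive x (suc y ∷ r) (inj₂ lt , zti)    = lt , afterPositive y r zti

vA-realises : ∀ P G → ZeroThenIncreasing G → All (_< suc P) G → length G ≡ suc P →
  Σ (Vec Bool P) λ A → vAList (suc (suc P)) A ≡ G ++ [ suc (lastOr0 G) ]
vA-realises P G zti bd len = A , (begin
  vAList (suc (suc P)) A                         ≡⟨ cong (λ xs → pad (suc P ∸ length xs) xs) D≡ ⟩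
  pad (suc P ∸ length D) D                       ≡⟨ cong (λ q → pad q D) zeros≡ ⟩
  pad (leadingZeros G) D                         ≡⟨ sym (++-assoc Z D _) ⟩
  (Z ++ D) ++ [ suc (lastOr0 D) ]
    ≡⟨ cong₂ (λ xs l → xs ++ [ suc l ]) (zeros++dropZeros G) (lastOr0-dropZeros G) ⟩
  G ++ [ suc (lastOr0 G) ]                       ∎)
  where
  open ≡-Reasoning
  pad : ℕ → List ℕ → List ℕ
  pad q xs = List.replicate q 0 ++ xs ++ [ suc (lastOr0 xs) ]
  D Z : List ℕ
  D = dropZeros G
  Z = List.replicate (leadingZeros G) 0
  onto : Σ (Vec Bool P) λ B → elemsFrom 1 B ≡ D
  onto = elemsFrom-onto P 1 D (dropZeros-increasing G zti) (All-dropZeros _ G bd)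
  A : Vec Bool P
  A = proj₁ onto
  D≡ : elemsFrom 1 A ≡ D
  D≡ = proj₂ onto
  zeros≡ : suc P ∸ length D ≡ leadingZeros G
  zeros≡ = trans (cong (_∸ length D) (trans (sym len) (length-dropZeros G))) (m+n∸n≡m (leadingZeros G) (length D))

nth-applyUpTo : ∀ f m i → i < m → nth (applyUpTo f m) i ≡ f i
nth-applyUpTo f (suc m) zero    lt       = refl
nth-applyUpTo f (suc m) (suc i) (s≤s lt) = nth-applyUpTo (λ i → f (suc i)) m i lt

lastOr0-applyUpTo : ∀ f m → lastOr0 (applyUpTo f (suc m)) ≡ f m
lastOr0-applyUpTo f zero    = refl
lastOr0-applyUpTo f (suc m) = lastOr0-applyUpTo (λ i → f (suc i)) m

All-applyUpTo : ∀ (Q : ℕ → Set) f m → (∀ p → p < m → Q (f p)) → All Q (applyUpTo f m)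
All-applyUpTo Q f zero    h = []
All-applyUpTo Q f (suc m) h = h 0 (s≤s z≤n) ∷ All-applyUpTo Q (λ i → f (suc i)) m (λ p lt → h (suc p) (s≤s lt))

zeroThenIncreasing-applyUpTo : ∀ f m → (∀ p → suc p < m → f p ≡ 0 ⊎ f p < f (suc p)) →
  ZeroThenIncreasing (applyUpTo f m)
zeroThenIncreasing-applyUpTo f zero          h = tt
zeroThenIncreasing-applyUpTo f (suc zero)    h = tt
zeroThenIncreasing-applyUpTo f (suc (suc m)) h =
  h 0 (s≤s (s≤s z≤n)) , zeroThenIncreasing-applyUpTo (λ i → f (suc i)) (suc m) (λ p lt → h (suc p) (s≤s lt))

Realises : (P : ℕ) → Vec Bool P → (ℕ → ℕ) → Set
Realises P A f = (∀ i → i < suc P → nth (vAList (suc (suc P)) A) i ≡ f i) ×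
                 nth (vAList (suc (suc P)) A) (suc P) ≡ suc (f P)

vA-realises-seq : ∀ P f → (∀ p → suc p < suc P → f p ≡ 0 ⊎ f p < f (suc p)) →
  (∀ p → p < suc P → f p ≤ P) →
  Σ (Vec Bool P) λ A → Realises P A f
vA-realises-seq P f zti bd = A , low , top
  where
  G : List ℕ
  G = applyUpTo f (suc P)
  len : length G ≡ suc P
  len = length-applyUpTo f (suc P)
  real : Σ (Vec Bool P) λ A → vAList (suc (suc P)) A ≡ G ++ [ suc (lastOr0 G) ]
  real = vA-realises P G (zeroThenIncreasing-applyUpTo f (suc P) zti)
           (All-applyUpTo _ f (suc P) (λ p lt → s≤s (bd p lt))) len
  A : Vec Bool P
  A = proj₁ real
  low : ∀ i → i < suc P → nth (vAList (suc (suc P)) A) i ≡ f i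
  low i lt = trans (cong (λ l → nth l i) (proj₂ real))
    (trans (nth-++ˡ G _ i (subst (i <_) (sym len) lt)) (nth-applyUpTo f (suc P) i lt))
  top : nth (vAList (suc (suc P)) A) (suc P) ≡ suc (f P)
  top = trans (cong (λ l → nth l (suc P)) (proj₂ real))
    (trans (cong (nth (G ++ _)) (sym (trans (+-identityʳ _) len)))
      (trans (nth-++ʳ G _ 0) (cong suc (lastOr0-applyUpTo f P))))

HB⊆L : ∀ k P → HB k (suc (suc P)) ⊆ L k (suc (suc P))
HB⊆L k P v (inj₁ (A , refl))   = ordered⇒L k (suc (suc P)) (nth (vAList (suc (suc P)) A)) (vA-ordered P A k)
HB⊆L k P v (inj₂ (Lv , _ , _)) = Lv

m∸[1+n]<m : ∀ m n → 0 < m → m ∸ suc n < m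
m∸[1+n]<m (suc m) n _ = s≤s (m∸n≤m m n)

module _ (k P : ℕ) (k≥1 : 1 ≤ k) where
  private
    n : ℕ
    n = suc (suc P)

  record Peel (g : ℕ → ℕ) : Set where
    field
      h r       : ℕ → ℕ
      h∈HB      : HB k n (toVec n h)
      r-ordered : Ordered k n r
      r-smaller : r (suc P) < g (suc P)
      h+r≡g     : ∀ i → i < n → h i + r i ≡ g i

  peel-top : ∀ g → Ordered k n g → den k P ≤ g P → Peel g
  peel-top g o big = record
    { h = h ; r = λ i → g i ∸ den k i
    ; h∈HB = inj₂ (ordered⇒L k n h (ordered-den⊓ k n g o) , atP , atTop)
    ; r-ordered = ordered-∸den k n g o
    ; r-smaller = m∸[1+n]<m (g (suc P)) _ (≤-trans (s≤s z≤n) big')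
    ; h+r≡g = λ i _ → m⊓n+n∸m≡n (den k i) (g i) }
    where
    h : ℕ → ℕ
    h i = den k i ⊓ g i
    big' : den k (suc P) ≤ g (suc P)
    big' = den≤-step k n g o P ≤-refl big
    atP : ∀ (i : Fin n) → toℕ i ≡ P → lookup (toVec n h) i ≡ + (P * k + 1)
    atP i ti rewrite lookup-toVec h i | ti = cong +_ (trans (m≤n⇒m⊓n≡m big) (+-comm 1 (P * k)))
    atTop : ∀ (i : Fin n) → toℕ i ≡ suc P → lookup (toVec n h) i ≡ + (suc P * k + 1)
    atTop i ti rewrite lookup-toVec h i | ti = cong +_ (trans (m≤n⇒m⊓n≡m big') (+-comm 1 (suc P * k)))

  -- If g_P < s_P, peel off the v_A with entries min(g_i, i) for i ≤ P and
  -- min(g_P, P) + 1 last; here g_i < s_i for all i ≤ P.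
  peel-staircase : ∀ g → Ordered k n g → g P < den k P → 0 < g (suc P) → Peel g
  peel-staircase g o small pos = record
    { h = h ; r = r ; h∈HB = inj₁ (A , refl) ; r-ordered = r-ordered
    ; r-smaller = subst (λ x → g (suc P) ∸ x < g (suc P)) (sym top) (m∸[1+n]<m (g (suc P)) _ pos)
    ; h+r≡g = λ i lt → m+[n∸m]≡n (h≤g i lt) }
    where
    f : ℕ → ℕ
    f p = g p ⊓ p

    -- f is zero, then strictly increasing, because g is.
    f-zti : ∀ p → suc p < suc P → f p ≡ 0 ⊎ f p < f (suc p)
    f-zti p lt with g p in eq
    ... | zero  = inj₁ refl
    ... | suc x = inj₂ (⊓-mono-< (subst (_< g (suc p)) eq gp<gsp) (n<1+n p))
      where
      lt' : suc p < n
      lt' = <-trans lt (n<1+n _)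
      gp<gsp : g p < g (suc p)
      gp<gsp = ordered-strict k n g k≥1 o p lt'
                 (<-≤-trans (subst (0 <_) (sym eq) (s≤s z≤n)) (ordered-step k n g o p lt'))

    realised : Σ (Vec Bool P) λ A → Realises P A f
    realised = vA-realises-seq P f f-zti (λ p lt → ≤-trans (m⊓n≤n (g p) p) (≤-pred lt))
    A : Vec Bool P
    A = proj₁ realised
    h : ℕ → ℕ
    h = nth (vAList n A)
    low : ∀ i → i < suc P → h i ≡ g i ⊓ i
    low = proj₁ (proj₂ realised)
    top : h (suc P) ≡ suc (g P ⊓ P)
    top = proj₂ (proj₂ realised)

    r : ℕ → ℕ
    r i = g i ∸ h i

    h≤g : ∀ i → i < n → h i ≤ g i
    h≤g i (s≤s i≤sP) with m≤n⇒m<n∨m≡n i≤sP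
    ... | inj₁ lt   = subst (_≤ g i) (sym (low i lt)) (m⊓n≤m (g i) i)
    ... | inj₂ refl = subst (_≤ g (suc P)) (sym top) lastStep
      where
      lastStep : suc (g P ⊓ P) ≤ g (suc P)
      lastStep with g P in eq
      ... | zero  = pos
      ... | suc x = ≤-<-trans (m⊓n≤m (suc x) P) (subst (_< g (suc P)) eq (ordered-strict k n g k≥1 o P ≤-refl pos))

    -- g stays below s up to P: otherwise s_P ≤ g_P by propagation.
    below-den : ∀ i → i ≤ P → ¬ (den k i ≤ g i)
    below-den i i≤P le = <-irrefl refl (<-≤-trans small
      (propagate n (λ j → den k j ≤ g j) (den≤-step k n g o) i≤P (<-trans (n<1+n P) (n<1+n (suc P))) le))

    -- Where g_i ≤ i, r_i = 0; where g_i > i, h_i = i and h_{i+1} = i + 1, and the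
    -- inequality g_i s_{i+1} ≤ g_{i+1} s_i is strict (by coprimality and g_i < s_i).
    r-ordered : Ordered k n r
    r-ordered i lt with g i ≤? i
    ... | yes gi≤i rewrite low i (≤-pred lt) | m≤n⇒m⊓n≡m gi≤i | n∸n≡0 (g i) = z≤n
    ... | no gi≰i = subst₂ (λ a b → (g i ∸ a) * den k (suc i) ≤ (g (suc i) ∸ b) * den k i)
                      (sym hi≡i) (sym hsi≡si) (shift-step k i (g i) (g (suc i)) strict)
      where
      i<gi : i < g i
      i<gi = ≰⇒> gi≰i
      gi>0 : 0 < g i
      gi>0 = ≤-<-trans z≤n i<gi
      gi<gsi : g i < g (suc i)
      gi<gsi = ordered-strict k n g k≥1 o i lt (<-≤-trans gi>0 (ordered-step k n g o i lt))
      hi≡i : h i ≡ i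
      hi≡i = trans (low i (≤-pred lt)) (m≥n⇒m⊓n≡n (<⇒≤ i<gi))
      hsi≡si : h (suc i) ≡ suc i
      hsi≡si with m≤n⇒m<n∨m≡n (≤-pred (≤-pred lt))
      ... | inj₁ i<P  = trans (low (suc i) (s≤s i<P)) (m≥n⇒m⊓n≡n (<-trans i<gi gi<gsi))
      ... | inj₂ refl = trans top (cong suc (m≥n⇒m⊓n≡n (<⇒≤ i<gi)))
      strict : suc (g i * den k (suc i)) ≤ g (suc i) * den k i
      strict = ≤∧≢⇒< (o i lt) λ e →
        below-den i (≤-pred (≤-pred lt)) (den-coprime k i (g i) (g (suc i)) k≥1 e gi>0)

  peel : ∀ g → Ordered k n g → 0 < g (suc P) → Peel g
  peel g o pos with g P <? den k P
  ... | yes small = peel-staircase g o small pos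
  ... | no ¬small = peel-top g o (≮⇒≥ ¬small)

  decompose-bounded : ∀ b g → Ordered k n g → g (suc P) ≤ b → InSemigroup (HB k n) (toVec n g)
  decompose-bounded b g o le with g (suc P) in eq
  ... | zero = [] , [] , trans (toVec-cong n g _ (ordered-zero k (suc P) g o eq)) (sym (toVec-0 n))
  decompose-bounded zero    g o () | suc x
  decompose-bounded (suc b) g o le | suc x =
    toVec n h ∷ us , h∈HB ∷ us∈HB , (begin
      toVec n g                                ≡⟨ toVec-cong n g _ (λ i lt → sym (h+r≡g i lt)) ⟩
      toVec n (λ i → h i + r i)                ≡⟨ sym (toVec-+ n h r) ⟩
      zipWith ℤ._+_ (toVec n h) (toVec n r)    ≡⟨ cong (zipWith ℤ._+_ (toVec n h)) r≡sum ⟩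
      zipWith ℤ._+_ (toVec n h) (sumV us)      ∎)
    where
    open ≡-Reasoning
    open Peel (peel g o (subst (0 <_) (sym eq) (s≤s z≤n)))
    rest : InSemigroup (HB k n) (toVec n r)
    rest = decompose-bounded b r r-ordered (≤-trans (≤-pred (subst (r (suc P) <_) eq r-smaller)) (≤-pred le))
    us : List (Vec ℤ n)
    us = proj₁ rest
    us∈HB : All (HB k n) us
    us∈HB = proj₁ (proj₂ rest)
    r≡sum : toVec n r ≡ sumV us
    r≡sum = proj₂ (proj₂ rest)

  HB-generates : Generates k n (HB k n)
  HB-generates = HB⊆L k P , λ v Lv →
    subst (InSemigroup (HB k n)) (sym (L⇒toVec k n v Lv))
      (decompose-bounded (coords v (suc P)) (coords v) (L⇒ordered k n v Lv) ≤-refl)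

L-sumV : ∀ k n us → All (L k n) us → L k n (sumV us)
L-sumV k n [] [] = subst (L k n) (sym (toVec-0 n)) (ordered⇒L k n (λ _ → 0) (λ _ _ → z≤n))
L-sumV k n (u ∷ us) (Lu ∷ Lus) = subst (L k n) (sym u+s≡)
    (ordered⇒L k n (λ i → coords u i + coords tot i)
      (ordered-+ k n (coords u) (coords tot) (L⇒ordered k n u Lu) (L⇒ordered k n tot Ls)))
  where
  tot : Vec ℤ n
  tot = sumV us
  Ls : L k n tot
  Ls = L-sumV k n us Lus
  u+s≡ : zipWith ℤ._+_ u tot ≡ toVec n (λ i → coords u i + coords tot i)
  u+s≡ = trans (cong₂ (zipWith ℤ._+_) (L⇒toVec k n u Lu) (L⇒toVec k n tot Ls)) (toVec-+ n (coords u) (coords tot))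

coords-+ : ∀ k n u w → L k n u → L k n w →
  ∀ i → i < n → coords (zipWith ℤ._+_ u w) i ≡ coords u i + coords w i
coords-+ k n u w Lu Lw i i<n = trans (cong (λ v → coords v i) u+w≡) (coords-toVec n _ i i<n)
  where
  u+w≡ : zipWith ℤ._+_ u w ≡ toVec n (λ i → coords u i + coords w i)
  u+w≡ = trans (cong₂ (zipWith ℤ._+_) (L⇒toVec k n u Lu) (L⇒toVec k n w Lw)) (toVec-+ n (coords u) (coords w))

module _ (k P : ℕ) (k≥1 : 1 ≤ k) where
  private
    n : ℕ
    n = suc (suc P)
    P<n : P < n
    P<n = <-trans (n<1+n P) (n<1+n (suc P))
    1+P<n : suc P < n
    1+P<n = n<1+n (suc P)

  TopOfHB : ℕ → ℕ → Set
  TopOfHB x y = y ≡ suc x ⊎ (x ≡ den k P × y ≡ den k (suc P))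

  HB-top : ∀ h → HB k n h → TopOfHB (coords h P) (coords h (suc P))
  HB-top h (inj₁ (A , refl)) = inj₁ (begin
    coords (vA n A) (suc P)       ≡⟨ coords-toVec n c (suc P) 1+P<n ⟩
    c (suc P)                     ≡⟨ vA-last-step P A ⟩
    suc (c P)                     ≡⟨ cong suc (sym (coords-toVec n c P P<n)) ⟩
    suc (coords (vA n A) P)       ∎)
    where
    open ≡-Reasoning
    c : ℕ → ℕ
    c = nth (vAList n A)
  HB-top h (inj₂ (_ , atP , atTop)) =
    inj₂ ( trans (coords-at h P _ P<n atP) (+-comm (P * k) 1)
         , trans (coords-at h (suc P) _ 1+P<n atTop) (+-comm (suc P * k) 1))

  TopOfHB⇒positive : ∀ {x y} → TopOfHB x y → 0 < y
  TopOfHB⇒positive (inj₁ refl)       = s≤s z≤n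
  TopOfHB⇒positive (inj₂ (_ , refl)) = s≤s z≤n

  HB-nonzero : ∀ h → HB k n h → h ≢ replicate n (+ 0)
  HB-nonzero h Hh h≡0 = <-irrefl (sym top≡0) (TopOfHB⇒positive (HB-top h Hh))
    where
    top≡0 : coords h (suc P) ≡ 0
    top≡0 = trans (cong (λ v → coords v (suc P)) (trans h≡0 (toVec-0 n))) (coords-toVec n (λ _ → 0) (suc P) 1+P<n)

  L-top-zero : ∀ v → L k n v → coords v (suc P) ≡ 0 → v ≡ replicate n (+ 0)
  L-top-zero v Lv e = trans (L⇒toVec k n v Lv)
    (trans (toVec-cong n (coords v) _ (ordered-zero k (suc P) (coords v) (L⇒ordered k n v Lv) e)) (sym (toVec-0 n)))

  -- The top entries of a sum a + b of nonzero ordered sequences are not those of an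
  -- element of H_{k,n}.  First, the last step of a + b is at least 2 ...
  sum-not-vA : ∀ a b → Ordered k n a → Ordered k n b → 0 < a (suc P) → 0 < b (suc P) →
    a (suc P) + b (suc P) ≢ suc (a P + b P)
  sum-not-vA a b oa ob pa pb e = 1+n≰n (begin
    suc (suc (a P + b P))       ≡⟨ cong suc (sym (+-suc (a P) (b P))) ⟩
    suc (a P) + suc (b P)
      ≤⟨ +-mono-≤ (ordered-strict k n a k≥1 oa P 1+P<n pa) (ordered-strict k n b k≥1 ob P 1+P<n pb) ⟩
    a (suc P) + b (suc P)       ≡⟨ e ⟩
    suc (a P + b P)             ∎)
    where open ≤-Reasoning

  -- ... and its top entries are not s_P, s_{P+1}: both inequalities
  -- a_P s_{P+1} ≤ a_{P+1} s_P, b_P s_{P+1} ≤ b_{P+1} s_P would be equalities, and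
  -- then coprimality gives s_P ≤ a_P and s_P ≤ b_P.
  sum-not-top : ∀ a b → Ordered k n a → Ordered k n b → 0 < a (suc P) → 0 < b (suc P) →
    ¬ (a P + b P ≡ den k P × a (suc P) + b (suc P) ≡ den k (suc P))
  sum-not-top a b oa ob pa pb (eP , eTop) = 1+n≰n overfull
    where
    S S' : ℕ
    S = den k P
    S' = den k (suc P)
    sums : a P * S' + b P * S' ≡ a (suc P) * S + b (suc P) * S
    sums = begin
      a P * S' + b P * S'           ≡⟨ sym (*-distribʳ-+ S' (a P) (b P)) ⟩
      (a P + b P) * S'              ≡⟨ cong (_* S') eP ⟩
      S * S'                        ≡⟨ *-comm S S' ⟩
      S' * S                        ≡⟨ cong (_* S) (sym eTop) ⟩
      (a (suc P) + b (suc P)) * S   ≡⟨ *-distribʳ-+ S (a (suc P)) (b (suc P)) ⟩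
      a (suc P) * S + b (suc P) * S ∎
      where open ≡-Reasoning
    tight : ∀ {x y x' y'} → x ≤ y → x' ≤ y' → x + x' ≡ y + y' → x ≡ y
    tight {x} {y} {x'} le le' e = ≤-antisym le (+-cancelʳ-≤ x' y x (≤-trans (+-monoʳ-≤ y le') (≤-reflexive (sym e))))
    eqA : a P * S' ≡ a (suc P) * S
    eqA = tight (oa P 1+P<n) (ob P 1+P<n) sums
    eqB : b P * S' ≡ b (suc P) * S
    eqB = tight (ob P 1+P<n) (oa P 1+P<n) (trans (+-comm (b P * S') _) (trans sums (+-comm (a (suc P) * S) _)))
    posP : ∀ c → c P * S' ≡ c (suc P) * S → 0 < c (suc P) → 0 < c P
    s≤aP : S ≤ a P
    s≤aP = den-coprime k P (a P) (a (suc P)) k≥1 eqA (posP a eqA pa)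
    s≤bP : S ≤ b P
    s≤bP = den-coprime k P (b P) (b (suc P)) k≥1 eqB (posP b eqB pb)
    posP c e p = n≢0⇒n>0 λ cP≡0 →
      <-irrefl (sym (m*n≡0⇒m≡0 (c (suc P)) S (trans (sym e) (cong (_* S') cP≡0)))) p
    overfull : suc S ≤ S
    overfull = begin
      suc S          ≡⟨ +-comm 1 S ⟩
      S + 1          ≤⟨ +-monoʳ-≤ S (≤-trans (s≤s z≤n) s≤bP) ⟩
      S + b P        ≤⟨ +-monoˡ-≤ (b P) s≤aP ⟩
      a P + b P      ≡⟨ eP ⟩
      S              ∎
      where open ≤-Reasoning

  sum-not-HB : ∀ a b → Ordered k n a → Ordered k n b → 0 < a (suc P) → 0 < b (suc P) →
    ¬ TopOfHB (a P + b P) (a (suc P) + b (suc P))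
  sum-not-HB a b oa ob pa pb (inj₁ last) = sum-not-vA a b oa ob pa pb last
  sum-not-HB a b oa ob pa pb (inj₂ top)  = sum-not-top a b oa ob pa pb top

  HB-irreducible : ∀ h → HB k n h → ∀ u w → L k n u → L k n w → h ≡ zipWith ℤ._+_ u w →
    u ≡ replicate n (+ 0) ⊎ w ≡ replicate n (+ 0)
  HB-irreducible h Hh u w Lu Lw h≡u+w with coords u (suc P) ≟ 0 | coords w (suc P) ≟ 0
  ... | yes a≡0 | _       = inj₁ (L-top-zero u Lu a≡0)
  ... | no _    | yes b≡0 = inj₂ (L-top-zero w Lw b≡0)
  ... | no a≢0  | no b≢0  =
    ⊥-elim (sum-not-HB a b (L⇒ordered k n u Lu) (L⇒ordered k n w Lw) (n≢0⇒n>0 a≢0) (n≢0⇒n>0 b≢0)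
              (subst₂ TopOfHB (h≡a+b P P<n) (h≡a+b (suc P) 1+P<n) (HB-top h Hh)))
    where
    a b : ℕ → ℕ
    a = coords u
    b = coords w
    h≡a+b : ∀ i → i < n → coords h i ≡ a i + b i
    h≡a+b i lt = trans (cong (λ v → coords v i) h≡u+w) (coords-+ k n u w Lu Lw i lt)

  -- Hence every generating set of L_{k,n} contains H_{k,n}: an element of H_{k,n}
  -- written as a sum of generators is one of them (the other summands vanish).
  HB⊆generating : ∀ (H' : VSet n) → Generates k n H' → HB k n ⊆ H'
  HB⊆generating H' (H'⊆L , gen) h Hh with gen h (HB⊆L k P h Hh)
  ... | us , us∈H' , h≡sum = summand us us∈H' (All.map (λ {u} → H'⊆L u) us∈H') h≡sum
    where
    summand : ∀ us → All H' us → All (L k n) us → h ≡ sumV us → H' h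
    summand []       _           _           e = ⊥-elim (HB-nonzero h Hh e)
    summand (u ∷ us) (u∈H' ∷ H's) (Lu ∷ Ls) e with HB-irreducible h Hh u (sumV us) Lu (L-sumV k n us Ls) e
    ... | inj₁ u≡0 = summand us H's Ls
          (trans e (trans (cong (λ x → zipWith ℤ._+_ x (sumV us)) u≡0) (zipWith-identityˡ ℤP.+-identityˡ (sumV us))))
    ... | inj₂ s≡0 = subst H' (sym (trans e (trans (cong (zipWith ℤ._+_ u) s≡0) (zipWith-identityʳ ℤP.+-identityʳ u))))
                           u∈H'

theorem3p1 : (k n : ℕ) → 1 ≤ k → 2 ≤ n →
    IsHilbertBasis k n (HB k n) ×
    (∀ (H : VSet n) → IsHilbertBasis k n H → ∀ v → H v ⇔ HB k n v)
theorem3p1 k (suc (suc P)) k≥1 (s≤s (s≤s z≤n)) = (generates , minimal) , unique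
  where
  generates : Generates k (suc (suc P)) (HB k (suc (suc P)))
  generates = HB-generates k P k≥1
  minimal : ∀ H' → H' ⊆ HB k (suc (suc P)) → Generates k (suc (suc P)) H' → HB k (suc (suc P)) ⊆ H'
  minimal H' _ = HB⊆generating k P k≥1 H'
  -- A Hilbert basis H contains H_{k,n}, and by its minimality equals it.
  unique : ∀ H → IsHilbertBasis k (suc (suc P)) H → ∀ v → H v ⇔ HB k (suc (suc P)) v
  unique H (genH , minH) v =
    mk⇔ (minH (HB k (suc (suc P))) (HB⊆generating k P k≥1 H genH) generates v) (HB⊆generating k P k≥1 H genH v)
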